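{- Let $\mathbb A=\langle\mathbf A_i,p_{ii'},I\rangle$ and $\mathbb B=\langle\mathbf B_j,q_{jj'},J\rangle$ be semilattice direct systems of Boolean algebras, $\mathbf A=\mathcal{P}_{\!\!\!l}(\mathbb A)$, $\mathbf B=\mathcal{P}_{\!\!\!l}(\mathbb B)$, $h:\mathbf A\to\mathbf B$ a homomorphism, and $\varphi_h:I\to J$ a map such that $h(A_i)\subseteq B_{\varphi_h(i)}$ for every $i\in I$. Then $\varphi_h$ is a semilattice homomorphism, i.e. $\varphi_h(i\vee i')=\varphi_h(i)\vee\varphi_h(i')$ for all $i,i'\in I$.
   Context: Boolean algebras are $\langle A,\wedge,\vee,{}',0,1\rangle$. A semilattice direct system of Boolean algebras is $\langle\mathbf A_i,p_{ii'},I\rangle$ where $I$ is a join semilattice with least element $i_0$, each $\mathbf A_i$ is a Boolean algebra, and for $i\le i'$, $p_{ii'}:\mathbf A_i\to\mathbf A_{i'}$ is a Boolean homomorphism, with $p_{ii}=\mathrm{id}$ and $p_{i'i''}\circ p_{ii'}=p_{ii''}$. Its P\l onka sum $\mathcal{P}_{\!\!\!l}(\mathbb A)$ is the algebra on the disjoint union $\bigsqcup_{i}A_i$ with: for $a\in A_i$, $b\in A_{i'}$, $k=i\vee i'$, $a\wedge b=p_{ik}(a)\wedge^{\mathbf A_k}p_{i'k}(b)$, $a\vee b=p_{ik}(a)\vee^{\mathbf A_k}p_{i'k}(b)$; $a'$ the complement in $\mathbf A_i$; $0,1$ the bounds of $\mathbf A_{i_0}$. Homomorphisms preserve $\wedge,\vee,{}',0,1$.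 -}

module Defs where

open import Level using (Level; _⊔_) renaming (suc to lsuc)
open import Data.Product using (Σ; _,_; proj₁; proj₂)
open import Relation.Binary.PropositionalEquality
  using (_≡_; refl; sym; trans; cong; subst)
open import Algebra.Structures using (IsIdempotentCommutativeMonoid)
open import Algebra.Lattice.Bundles using (BooleanAlgebra)

record IsBoolHom {c₁ ℓ₁ c₂ ℓ₂} (X : BooleanAlgebra c₁ ℓ₁) (Y : BooleanAlgebra c₂ ℓ₂)
       (f : BooleanAlgebra.Carrier X → BooleanAlgebra.Carrier Y) : Set (c₁ ⊔ ℓ₁ ⊔ ℓ₂) where
  private
    module X = BooleanAlgebra X
    module Y = BooleanAlgebra Y
  field
    cong-≈  : ∀ {x y} → x X.≈ y → f x Y.≈ f y
    pres-∧  : ∀ x y → f (x X.∧ y) Y.≈ (f x Y.∧ f y)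
    pres-∨  : ∀ x y → f (x X.∨ y) Y.≈ (f x Y.∨ f y)
    pres-¬  : ∀ x → f (X.¬ x) Y.≈ (Y.¬ f x)
    pres-⊥  : f X.⊥ Y.≈ Y.⊥
    pres-⊤  : f X.⊤ Y.≈ Y.⊤

record SDS (a c ℓ : Level) : Set (lsuc (a ⊔ c ⊔ ℓ)) where
  infixr 6 _⊔ᵢ_
  field
    I      : Set a
    _⊔ᵢ_   : I → I → I
    i₀     : I
    isJSL  : IsIdempotentCommutativeMonoid _≡_ _⊔ᵢ_ i₀

  _≤ᵢ_ : I → I → Set a
  i ≤ᵢ i' = (i ⊔ᵢ i') ≡ i'

  field
    A      : I → BooleanAlgebra c ℓ
    p      : ∀ {i i'} → i ≤ᵢ i' → BooleanAlgebra.Carrier (A i) → BooleanAlgebra.Carrier (A i')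
    p-hom  : ∀ {i i'} (le : i ≤ᵢ i') → IsBoolHom (A i) (A i') (p le)
    p-id   : ∀ {i} (le : i ≤ᵢ i) x → BooleanAlgebra._≈_ (A i) (p le x) x
    p-comp : ∀ {i i' i''} (le₁ : i ≤ᵢ i') (le₂ : i' ≤ᵢ i'') (le₃ : i ≤ᵢ i'') x →
             BooleanAlgebra._≈_ (A i'') (p le₂ (p le₁ x)) (p le₃ x)

  open IsIdempotentCommutativeMonoid isJSL using (assoc; comm; idem)

  ≤-⊔ˡ : ∀ i j → i ≤ᵢ (i ⊔ᵢ j)
  ≤-⊔ˡ i j = trans (sym (assoc i i j)) (cong (_⊔ᵢ j) (idem i))

  ≤-⊔ʳ : ∀ i j → j ≤ᵢ (i ⊔ᵢ j)
  ≤-⊔ʳ i j = trans (cong (j ⊔ᵢ_) (comm i j)) (trans (≤-⊔ˡ j i) (comm j i))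

  Pl : Set (a ⊔ c)
  Pl = Σ I (λ i → BooleanAlgebra.Carrier (A i))

  infixr 7 _∧ₚ_
  infixr 6 _∨ₚ_
  _∧ₚ_ : Pl → Pl → Pl
  (i , x) ∧ₚ (j , y) = (i ⊔ᵢ j) , BooleanAlgebra._∧_ (A (i ⊔ᵢ j)) (p (≤-⊔ˡ i j) x) (p (≤-⊔ʳ i j) y)

  _∨ₚ_ : Pl → Pl → Pl
  (i , x) ∨ₚ (j , y) = (i ⊔ᵢ j) , BooleanAlgebra._∨_ (A (i ⊔ᵢ j)) (p (≤-⊔ˡ i j) x) (p (≤-⊔ʳ i j) y)

  ¬ₚ_ : Pl → Pl
  ¬ₚ (i , x) = i , BooleanAlgebra.¬_ (A i) x

  0ₚ : Pl
  0ₚ = i₀ , BooleanAlgebra.⊥ (A i₀)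

  1ₚ : Pl
  1ₚ = i₀ , BooleanAlgebra.⊤ (A i₀)

  infix 4 _≈ₚ_
  _≈ₚ_ : Pl → Pl → Set (a ⊔ ℓ)
  (i , x) ≈ₚ (j , y) = Σ (i ≡ j) (λ e → BooleanAlgebra._≈_ (A j) (subst (λ k → BooleanAlgebra.Carrier (A k)) e x) y)

record IsPlHom {a c ℓ b d m} (𝔸 : SDS a c ℓ) (𝔹 : SDS b d m)
       (h : SDS.Pl 𝔸 → SDS.Pl 𝔹) : Set (a ⊔ c ⊔ ℓ ⊔ b ⊔ m) where
  private
    module 𝔸 = SDS 𝔸
    module 𝔹 = SDS 𝔹
  field
    cong-≈ : ∀ {x y} → x 𝔸.≈ₚ y → h x 𝔹.≈ₚ h y
    pres-∧ : ∀ x y → h (x 𝔸.∧ₚ y) 𝔹.≈ₚ (h x 𝔹.∧ₚ h y)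
    pres-∨ : ∀ x y → h (x 𝔸.∨ₚ y) 𝔹.≈ₚ (h x 𝔹.∨ₚ h y)
    pres-¬ : ∀ x → h (𝔸.¬ₚ x) 𝔹.≈ₚ (𝔹.¬ₚ h x)
    pres-0 : h 𝔸.0ₚ 𝔹.≈ₚ 𝔹.0ₚ
    pres-1 : h 𝔸.1ₚ 𝔹.≈ₚ 𝔹.1ₚ

module Submission where

open import Defs
open import Data.Product using (_,_; proj₁)
open import Relation.Binary.PropositionalEquality using (_≡_; cong₂; module ≡-Reasoning)
open import Algebra.Lattice.Bundles using (BooleanAlgebra)

index-∘-pres-∧ : ∀ {a c ℓ b d m} (𝔸 : SDS a c ℓ) (𝔹 : SDS b d m)
                 {h : SDS.Pl 𝔸 → SDS.Pl 𝔹} → IsPlHom 𝔸 𝔹 h →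
                 ∀ x y → proj₁ (h (SDS._∧ₚ_ 𝔸 x y))
                         ≡ SDS._⊔ᵢ_ 𝔹 (proj₁ (h x)) (proj₁ (h y))
index-∘-pres-∧ 𝔸 𝔹 hom x y = proj₁ (IsPlHom.pres-∧ hom x y)

lemma4p4 : ∀ {a c ℓ b d m} (𝔸 : SDS a c ℓ) (𝔹 : SDS b d m)
    (h : SDS.Pl 𝔸 → SDS.Pl 𝔹) → IsPlHom 𝔸 𝔹 h →
    (φ : SDS.I 𝔸 → SDS.I 𝔹) →
    (∀ i x → proj₁ (h (i , x)) ≡ φ i) →
    ∀ i i' → φ (SDS._⊔ᵢ_ 𝔸 i i') ≡ SDS._⊔ᵢ_ 𝔹 (φ i) (φ i')
lemma4p4 𝔸 𝔹 h hom φ hφ i i' = begin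
  φ (i ⊔ i')                                    ≡⟨ hφ (i ⊔ i') _ ⟨
  proj₁ (h ((i , ⊤ i) ∧ₚ (i' , ⊤ i')))          ≡⟨ index-∘-pres-∧ 𝔸 𝔹 hom (i , ⊤ i) (i' , ⊤ i') ⟩
  proj₁ (h (i , ⊤ i)) ⊔ᴮ proj₁ (h (i' , ⊤ i'))  ≡⟨ cong₂ _⊔ᴮ_ (hφ i (⊤ i)) (hφ i' (⊤ i')) ⟩
  φ i ⊔ᴮ φ i'                                   ∎
  where
  open ≡-Reasoning
  open SDS 𝔸 renaming (_⊔ᵢ_ to _⊔_)
  open SDS 𝔹 using () renaming (_⊔ᵢ_ to _⊔ᴮ_)
  -- Any elements of A i and A i' would do; ⊤ just witnesses that the fibres are inhabited.
  ⊤ : ∀ j → BooleanAlgebra.Carrier (A j)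
  ⊤ j = BooleanAlgebra.⊤ (A j)
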